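{- Let $(A,r)$ be a greedy system with respect to $(\mathcal{L},\preceq)$. Let $S,T\in\mathcal{L}$ with $S\preceq T$ and let $e\in E$. Then $\varphi_e(S)\preceq\varphi_e(T)$.
   Context: Let $E$ be a finite set of columns (elements), $\mathcal{L}$ a finite set of row indices, $A=(a_{i,e})\in\mathbb{R}_{\ge 0}^{\mathcal{L}\times E}$ and $r:\mathcal{L}\to\mathbb{R}$ (the rank). For a row $i$ let $\mathrm{supp}(i)=\{e\in E: a_{i,e}>0\}$. Let $\preceq$ be a partial order on $\mathcal{L}$. The system $(A,r)$ is a greedy system with respect to $(\mathcal{L},\preceq)$ if: (P1) $r(S)\le r(T)$ whenever $S\preceq T$; (P2) for every $e\in E$, $a_{S,e}\le a_{T,e}$ whenever $S\preceq T$; (P3) $(\mathcal{L},\preceq)$ is a modular lattice with join $\vee$ and meet $\wedge$, distinct rows have distinct supports, and for all $i,j\in\mathcal{L}$, $e\in E$: $e\notin\mathrm{supp}(i)\cup\mathrm{supp}(j)$ implies $e\notin\mathrm{supp}(i\vee j)$; (P4) $\frac{r(T)-r(S\wedge T)}{a_{T,e}}\le\frac{r(S\vee T)-r(S)}{a_{S\vee T,e}}$ for all $S,T\in\mathcal{L}$ and $e\in T\setminus(S\wedge T)$. Since supports are distinct, each row is identified with its support: $S\in\mathcal{L}$ denotes the row with support $S\subseteq E$, and $e\in S$ means $a_{S,e}>0$. For $S\in\mathcal{L}$ and $e\in E$, $\varphi_e(S)=\max\{T\in\mathcal{L}: T\preceq S,\ e\notin T\}$ (the maximum row below $S$ not containing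 $e$). -}

module Defs where

open import Level using (Level; _⊔_) renaming (suc to lsuc)
open import Data.Nat using (ℕ)
open import Data.Fin using (Fin)
open import Data.Product using (_×_; Σ-syntax)
open import Relation.Nullary using (¬_)
open import Relation.Binary.PropositionalEquality using (_≡_)
open import Relation.Binary.Lattice.Structures using (IsLattice)

-- Scalars (standing in for ℝ; ℝ is not available in agda-stdlib).
-- Only the operations used in (P1)-(P4) are required; no axioms are
-- imposed, so the statement below is at least as general as the real one.
record Scalars (c ℓ : Level) : Set (lsuc (c ⊔ ℓ)) where
  field
    Carrier : Set c
    0#      : Carrier
    _-_     : Carrier → Carrier → Carrier
    _/_     : Carrier → Carrier → Carrier
    _≤_     : Carrier → Carrier → Set ℓ
    _<_     : Carrier → Carrier → Set ℓ

-- A greedy system (A , r) w.r.t. (ℒ , ⪯), with ℒ = Fin m (rows) and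
-- E = Fin n (columns).  e ∈ S means 0 < a S e.
record GreedySystem {c ℓ : Level} (K : Scalars c ℓ) (m n : ℕ) : Set (lsuc (c ⊔ ℓ)) where
  open Scalars K
  field
    a   : Fin m → Fin n → Carrier
    r   : Fin m → Carrier
    _⪯_ : Fin m → Fin m → Set
    _∨_ : Fin m → Fin m → Fin m
    _∧_ : Fin m → Fin m → Fin m
    nonneg    : ∀ i e → 0# ≤ a i e
    P1        : ∀ S T → S ⪯ T → r S ≤ r T
    P2        : ∀ S T e → S ⪯ T → a S e ≤ a T e
    isLattice : IsLattice _≡_ _⪯_ _∨_ _∧_
    modular   : ∀ x y z → x ⪯ z → (x ∨ (y ∧ z)) ≡ ((x ∨ y) ∧ z)
    suppInj   : ∀ i j → (∀ e → (0# < a i e → 0# < a j e) × (0# < a j e → 0# < a i e)) → i ≡ j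
    joinSupp  : ∀ i j e → ¬ (0# < a i e) → ¬ (0# < a j e) → ¬ (0# < a (i ∨ j) e)
    P4        : ∀ S T e → 0# < a T e → ¬ (0# < a (S ∧ T) e) →
                ((r T - r (S ∧ T)) / a T e) ≤ ((r (S ∨ T) - r S) / a (S ∨ T) e)

  IsPhi : Fin n → Fin m → Fin m → Set ℓ
  IsPhi e S X = (X ⪯ S) × (¬ (0# < a X e)) ×
                (∀ T → T ⪯ S → ¬ (0# < a T e) → T ⪯ X)

module Submission where

open import Defs
open import Level using (Level)
open import Data.Nat using (ℕ)
open import Data.Fin using (Fin)
open import Data.Product using (_,_)
open import Relation.Binary.Lattice.Structures using (IsLattice)

lemma1 : {c ℓ : Level} (K : Scalars c ℓ) (m n : ℕ) (G : GreedySystem K m n) →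
         (S T : Fin m) → GreedySystem._⪯_ G S T → (e : Fin n) →
         (φS φT : Fin m) → GreedySystem.IsPhi G e S φS → GreedySystem.IsPhi G e T φT →
         GreedySystem._⪯_ G φS φT
lemma1 K m n G S T S⪯T e φS φT (φS⪯S , e∉φS , _) (_ , _ , φT-maximum) =
  φT-maximum φS (IsLattice.trans isLattice φS⪯S S⪯T) e∉φS
  where open GreedySystem G
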